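{- For every integer $g \geq 3$ there exist a graph $G$ with girth $g$ and an $N\in\mathbb{N}$ such that $P_{DP}(G,m) < P(G,m)$ for every integer $m \geq N$.
   Context: All graphs are finite and simple. For $m\in\mathbb{N}$, $P(G,m)$ denotes the number of proper $m$-colorings of $G$. A cover of a graph $G$ is a pair $\mathcal{H}=(L,H)$ where $H$ is a graph and $L:V(G)\to\mathcal{P}(V(H))$ satisfies: (1) the sets $L(u)$, $u\in V(G)$, partition $V(H)$; (2) each $H[L(u)]$ is complete; (3) if $E_H(L(u),L(v))$ is nonempty then $u=v$ or $uv\in E(G)$; (4) if $uv\in E(G)$ then $E_H(L(u),L(v))$ is a matching (possibly empty). Here $E_H(S,U)$ is the set of edges of $H$ with one endpoint in $S$ and one in $U$. The cover is $m$-fold if $|L(u)|=m$ for all $u$. An $\mathcal{H}$-coloring of $G$ is an independent set of $H$ of size $|V(G)|$. $P_{DP}(G,\mathcal{H})$ is the number of $\mathcal{H}$-colorings, and $P_{DP}(G,m)$ is the minimum of $P_{DP}(G,\mathcal{H})$ over all $m$-fold covers $\mathcal{H}$ of $G$. -}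

module Defs where

import Data.Nat
open import Data.Nat using (ℕ; zero; suc; _+_; _≤_; _<_)
open import Data.Bool using (Bool; true; false)
open import Data.Fin using (Fin; inject₁; fromℕ) renaming (zero to fzero; suc to fsuc)
open import Data.Fin.Properties using (all?; _≟_)
open import Data.Vec using (Vec; []; _∷_; lookup; count)
open import Data.List using (List; []; _∷_; map; concatMap; length; filter; allFin)
open import Data.Product using (Σ; _×_; _,_)
open import Data.Empty using (⊥)
open import Data.Sum using (_⊎_)
open import Relation.Nullary using (¬_; Dec; yes; no)
open import Relation.Nullary.Decidable using (_→-dec_; ¬?)
open import Relation.Binary.PropositionalEquality using (_≡_; _≢_)
open import Data.Bool.Properties using () renaming (_≟_ to _≟B_)
open import Function.Definitions using (Injective)

record Graph : Set where
  field
    n      : ℕ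
    adj    : Fin n → Fin n → Bool
    sym    : ∀ u v → adj u v ≡ adj v u
    irrefl : ∀ u → adj u u ≡ false
open Graph public

-- A cycle of length (suc k) in G: distinct vertices c 0, …, c k with
-- c i ~ c (i+1) and c k ~ c 0.
record Cycle (G : Graph) (k : ℕ) : Set where
  field
    c      : Fin (suc k) → Fin (n G)
    inj    : Injective _≡_ _≡_ c
    step   : ∀ (i : Fin k) → adj G (c (inject₁ i)) (c (fsuc i)) ≡ true
    close  : adj G (c (fromℕ k)) (c fzero) ≡ true

HasCycleOfLength : Graph → ℕ → Set
HasCycleOfLength G zero    = ⊥
HasCycleOfLength G (suc k) = (3 ≤ suc k) × Cycle G k

HasGirth : Graph → ℕ → Set
HasGirth G g = HasCycleOfLength G g × (∀ ℓ → ℓ < g → ¬ HasCycleOfLength G ℓ)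

allVecs : {A : Set} (k : ℕ) → List A → List (Vec A k)
allVecs zero    xs = [] ∷ []
allVecs (suc k) xs = concatMap (λ v → map (λ x → x ∷ v) xs) (allVecs k xs)

countL : {A : Set} {P : A → Set} → (∀ x → Dec (P x)) → List A → ℕ
countL P? xs = length (filter P? xs)

Proper : (G : Graph) (m : ℕ) → Vec (Fin m) (n G) → Set
Proper G m col = ∀ u v → adj G u v ≡ true → ¬ (lookup col u ≡ lookup col v)

proper? : (G : Graph) (m : ℕ) → ∀ col → Dec (Proper G m col)
proper? G m col = all? λ u → all? λ v →
  (adj G u v ≟B true) →-dec ¬? (lookup col u ≟ lookup col v)

chromPoly : Graph → ℕ → ℕ
chromPoly G m = countL (proper? G m) (allVecs (n G) (allFin m))

-- An m-fold cover (L, H) of G.  V(H) = Fin n × Fin m with L(u) = {u} × Fin m;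
-- hadj u i v j says (u,i) and (v,j) are adjacent in H.
record Cover (G : Graph) (m : ℕ) : Set where
  field
    hadj     : Fin (n G) → Fin m → Fin (n G) → Fin m → Bool
    hsym     : ∀ u i v j → hadj u i v j ≡ hadj v j u i
    hirrefl  : ∀ u i → hadj u i u i ≡ false
    clique   : ∀ u i j → i ≢ j → hadj u i u j ≡ true
    edgeOnly : ∀ u i v j → hadj u i v j ≡ true → (u ≡ v) ⊎ (adj G u v ≡ true)
    matching : ∀ u v → adj G u v ≡ true →
               (∀ i j j' → hadj u i v j ≡ true → hadj u i v j' ≡ true → j ≡ j') ×
               (∀ i i' j → hadj u i v j ≡ true → hadj u i' v j ≡ true → i ≡ i')
open Cover public

Subset : (G : Graph) (m : ℕ) → Set
Subset G m = Vec (Vec Bool m) (n G)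

_∈S_ : ∀ {k m} → (Fin k × Fin m) → Vec (Vec Bool m) k → Set
(u , i) ∈S S = lookup (lookup S u) i ≡ true

∈S? : ∀ {k m} x (S : Vec (Vec Bool m) k) → Dec (x ∈S S)
∈S? (u , i) S = lookup (lookup S u) i ≟B true

size : ∀ {k m} → Vec (Vec Bool m) k → ℕ
size []       = 0
size (r ∷ S)  = count (λ b → b ≟B true) r + size S

Independent : ∀ {G m} → Cover G m → Subset G m → Set
Independent H S = ∀ u i v j → (u , i) ∈S S → (v , j) ∈S S → hadj H u i v j ≡ false

independent? : ∀ {G m} (H : Cover G m) S → Dec (Independent H S)
independent? H S = all? λ u → all? λ i → all? λ v → all? λ j →
  ∈S? (u , i) S →-dec (∈S? (v , j) S →-dec (hadj H u i v j ≟B false))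

IsHColoring : ∀ {G m} → Cover G m → Subset G m → Set
IsHColoring {G} H S = Independent H S × size S ≡ n G

isHColoring? : ∀ {G m} (H : Cover G m) S → Dec (IsHColoring H S)
isHColoring? {G} H S with independent? H S | size S Data.Nat.≟ n G
... | yes a | yes b = yes (a , b)
... | no ¬a | _     = no λ { (a , _) → ¬a a }
... | _     | no ¬b = no λ { (_ , b) → ¬b b }

dpCount : ∀ {G m} → Cover G m → ℕ
dpCount {G} {m} H = countL (isHColoring? H) (allVecs (n G) (allVecs m (true ∷ false ∷ [])))

IsDPChromaticValue : Graph → ℕ → ℕ → Set
IsDPChromaticValue G m k = Σ (Cover G m) (λ H → dpCount H ≡ k) × (∀ (H : Cover G m) → k ≤ dpCount H)

module Submission where

open import Defs
open import Data.Nat using (ℕ; _≤_; _<_)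
open import Data.Product using (Σ; _×_)

open import Data.Nat using (zero; suc; _+_; _*_; _∸_; z≤n; s≤s; s≤s⁻¹; _<?_; _≤?_; >-nonZero) renaming (_≟_ to _≟ℕ_)
open import Data.Nat.Properties hiding (_≟_)
open import Data.Nat.DivMod using (_%_; _mod_; m<n⇒m%n≡m; %-distribˡ-+; m%n%n≡m%n; [m+n]%n≡m%n; n%n≡0; m≤n⇒[n∸m]%m≡n%m)
open import Data.Nat.GeneralisedArithmetic using (fold)
open import Data.Nat.Tactic.RingSolver using (solve-∀)
open import Algebra.Properties.CommutativeSemigroup +-commutativeSemigroup using () renaming (interchange to +-interchange)
open import Data.Bool using (Bool; true; false; if_then_else_)
open import Data.Bool.Properties using () renaming (_≟_ to _≟B_)
open import Data.Fin using (Fin; toℕ; fromℕ; inject₁; lower₁; _↑ˡ_; _↑ʳ_; splitAt; join) renaming (zero to fzero; suc to fsuc)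
open import Data.Fin.Properties
  using (_≟_; all?; toℕ-injective; toℕ-fromℕ<; toℕ-fromℕ; toℕ-inject₁; toℕ<n; inject₁-lower₁; fromℕ≢inject₁; injective⇒≤;
         splitAt-↑ˡ; splitAt-↑ʳ; join-splitAt; ↑ˡ-injective; ↑ʳ-injective)
  renaming (suc-injective to fsuc-injective)
open import Data.Vec using (Vec; []; _∷_; lookup; _++_; replicate; count)
open import Data.Vec.Properties using (lookup-++ˡ; lookup-++ʳ; lookup-map; lookup-replicate; lookup∘tabulate; ≡-dec)
open import Data.List using (List; []; _∷_; map; concatMap; allFin; tabulate) renaming (_++_ to _++ᴸ_)
open import Data.Product using (_,_; proj₁; proj₂; ∃)
open import Data.Sum using (_⊎_; inj₁; inj₂; [_,_]′)
open import Data.Unit using (⊤; tt)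
open import Data.Empty using (⊥)
open import Function using (_∘_; _⇔_; mk⇔; Injective; Equivalence)
open import Relation.Nullary using (¬_; Dec; yes; no; does; contradiction)
open import Relation.Nullary.Decidable using (_×-dec_; _⊎-dec_; _→-dec_; ¬?; dec-true; dec-false; does-⇔)
open import Relation.Binary.Definitions using (tri<; tri≈; tri>)
open import Relation.Binary.PropositionalEquality renaming (sym to ≡-sym)

-- For every g ≥ 3 the graph G = C_g ⊎ C_2g has P_DP(G, m) < P(G, m) for m ≥ 3.
--
-- Both cycles are orbits of one successor map s on the vertices: u and v are
-- adjacent when one is the image of the other under s.  A colouring c is
-- τ-twisted if c (s u) differs from τ u (c u) for every u, where each τ u
-- permutes the colours.  The proper colourings are the identity-twisted
-- ones, and any τ defines an m-fold cover (matching (u , i) with (s u , τ u i))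
-- whose DP-colourings are exactly the τ-twisted colourings.  Twisted
-- colourings of the union are pairs of twisted colourings of the cycles; on
-- a cycle of length k + 1 twisted only on its closing edge they are counted
-- by a two-state transfer recursion, giving m · P k without twist and
-- m · Q k for a fixed-point-free twist, where P k - Q k = ±1 alternates with
-- the parity of k.  Twisting the even cycle by a rotation of the colours
-- thus yields a cover with fewer than P(G, m) colourings.  Since covers are
-- coded by finite tables, the minimum P_DP(G, m) is attained, and it lies
-- below that cover's count.  The girth is g because every cycle of the
-- successor graph contains the whole s-orbit of its vertices.

variable
  A B : Set

𝟙 : {P : Set} → Dec P → ℕ
𝟙 p? = if does p? then 1 else 0

𝟙-⇔ : {P Q : Set} (p? : Dec P) (q? : Dec Q) → P ⇔ Q → 𝟙 p? ≡ 𝟙 q?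
𝟙-⇔ p? q? P⇔Q = cong (λ b → if b then 1 else 0) (does-⇔ P⇔Q p? q?)

𝟙-yes : {P : Set} (p? : Dec P) → P → 𝟙 p? ≡ 1
𝟙-yes p? p rewrite dec-true p? p = refl

𝟙-no : {P : Set} (p? : Dec P) → ¬ P → 𝟙 p? ≡ 0
𝟙-no p? ¬p rewrite dec-false p? ¬p = refl

𝟙-× : {P Q : Set} (p? : Dec P) (q? : Dec Q) → 𝟙 (p? ×-dec q?) ≡ 𝟙 p? * 𝟙 q?
𝟙-× (yes _) (yes _) = refl
𝟙-× (yes _) (no _)  = refl
𝟙-× (no _)  _       = refl

does⇒ : {P : Set} (p? : Dec P) → does p? ≡ true → P
does⇒ (yes p) _ = p

∑ : List A → (A → ℕ) → ℕ
∑ []       f = 0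
∑ (x ∷ xs) f = f x + ∑ xs f

∑-cong : (xs : List A) {f g : A → ℕ} → (∀ x → f x ≡ g x) → ∑ xs f ≡ ∑ xs g
∑-cong []       f≗g = refl
∑-cong (x ∷ xs) f≗g = cong₂ _+_ (f≗g x) (∑-cong xs f≗g)

∑-+ : (xs : List A) (f g : A → ℕ) → ∑ xs (λ x → f x + g x) ≡ ∑ xs f + ∑ xs g
∑-+ []       f g = refl
∑-+ (x ∷ xs) f g = trans (cong (f x + g x +_) (∑-+ xs f g)) (+-interchange (f x) (g x) (∑ xs f) (∑ xs g))

∑-*ˡ : (xs : List A) (c : ℕ) (f : A → ℕ) → ∑ xs (λ x → c * f x) ≡ c * ∑ xs f
∑-*ˡ []       c f = ≡-sym (*-zeroʳ c)
∑-*ˡ (x ∷ xs) c f = trans (cong (c * f x +_) (∑-*ˡ xs c f)) (≡-sym (*-distribˡ-+ c (f x) _))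

∑-*ʳ : (xs : List A) (c : ℕ) (f : A → ℕ) → ∑ xs (λ x → f x * c) ≡ ∑ xs f * c
∑-*ʳ xs c f = trans (∑-cong xs (λ x → *-comm (f x) c)) (trans (∑-*ˡ xs c f) (*-comm c _))

∑-zero : (xs : List A) → ∑ xs (λ _ → 0) ≡ 0
∑-zero []       = refl
∑-zero (x ∷ xs) = ∑-zero xs

∑-++ : (xs ys : List A) (f : A → ℕ) → ∑ (xs ++ᴸ ys) f ≡ ∑ xs f + ∑ ys f
∑-++ []       ys f = refl
∑-++ (x ∷ xs) ys f = trans (cong (f x +_) (∑-++ xs ys f)) (≡-sym (+-assoc (f x) _ _))

∑-concatMap : (g : A → List B) (xs : List A) (f : B → ℕ) →
  ∑ (concatMap g xs) f ≡ ∑ xs (λ x → ∑ (g x) f)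
∑-concatMap g []       f = refl
∑-concatMap g (x ∷ xs) f = trans (∑-++ (g x) (concatMap g xs) f) (cong (∑ (g x) f +_) (∑-concatMap g xs f))

∑-map : (h : B → A) (ys : List B) (f : A → ℕ) → ∑ (map h ys) f ≡ ∑ ys (f ∘ h)
∑-map h []       f = refl
∑-map h (y ∷ ys) f = cong (f (h y) +_) (∑-map h ys f)

∑-swap : (xs : List A) (ys : List B) (f : A → B → ℕ) →
  ∑ xs (λ x → ∑ ys (f x)) ≡ ∑ ys (λ y → ∑ xs (λ x → f x y))
∑-swap []       ys f = ≡-sym (∑-zero ys)
∑-swap (x ∷ xs) ys f =
  trans (cong (∑ ys (f x) +_) (∑-swap xs ys f)) (≡-sym (∑-+ ys (f x) (λ y → ∑ xs (λ x′ → f x′ y))))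

countL≡∑𝟙 : {P : A → Set} (P? : ∀ x → Dec (P x)) (xs : List A) → countL P? xs ≡ ∑ xs (𝟙 ∘ P?)
countL≡∑𝟙 P? []       = refl
countL≡∑𝟙 P? (x ∷ xs) with P? x
... | yes _ = cong suc (countL≡∑𝟙 P? xs)
... | no _  = countL≡∑𝟙 P? xs

∑F : ∀ m → (Fin m → ℕ) → ℕ
∑F zero    f = 0
∑F (suc m) f = f fzero + ∑F m (f ∘ fsuc)

∑F-cong : ∀ m {f g : Fin m → ℕ} → (∀ x → f x ≡ g x) → ∑F m f ≡ ∑F m g
∑F-cong zero    f≗g = refl
∑F-cong (suc m) f≗g = cong₂ _+_ (f≗g fzero) (∑F-cong m (f≗g ∘ fsuc))

∑F-const : ∀ m c → ∑F m (λ _ → c) ≡ m * c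
∑F-const zero    c = refl
∑F-const (suc m) c = cong (c +_) (∑F-const m c)

∑-tabulate : {m : ℕ} (h : Fin m → A) (f : A → ℕ) → ∑ (tabulate h) f ≡ ∑F m (f ∘ h)
∑-tabulate {m = zero}  h f = refl
∑-tabulate {m = suc m} h f = cong (f (h fzero) +_) (∑-tabulate (h ∘ fsuc) f)

∑-allFin : ∀ m (f : Fin m → ℕ) → ∑ (allFin m) f ≡ ∑F m f
∑-allFin m f = ∑-tabulate (λ x → x) f

∑V : List A → ∀ k → (Vec A k → ℕ) → ℕ
∑V xs k f = ∑ (allVecs k xs) f

module _ (xs : List A) where

  ∑V-cong : ∀ k {f g : Vec A k → ℕ} → (∀ v → f v ≡ g v) → ∑V xs k f ≡ ∑V xs k g
  ∑V-cong k = ∑-cong (allVecs k xs)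

  ∑V-suc : ∀ k (f : Vec A (suc k) → ℕ) → ∑V xs (suc k) f ≡ ∑V xs k (λ v → ∑ xs (λ x → f (x ∷ v)))
  ∑V-suc k f = trans (∑-concatMap _ (allVecs k xs) f) (∑V-cong k (λ v → ∑-map (_∷ v) xs f))

  ∑V-++ : ∀ a b (f : Vec A (a + b) → ℕ) → ∑V xs (a + b) f ≡ ∑V xs a (λ u → ∑V xs b (λ w → f (u ++ w)))
  ∑V-++ zero    b f = ≡-sym (+-identityʳ _)
  ∑V-++ (suc a) b f = begin
    ∑V xs (suc a + b) f                                           ≡⟨ ∑V-suc (a + b) f ⟩
    ∑V xs (a + b) (λ v → ∑ xs (λ x → f (x ∷ v)))                  ≡⟨ ∑V-++ a b _ ⟩
    ∑V xs a (λ u → ∑V xs b (λ w → ∑ xs (λ x → f (x ∷ u ++ w))))  ≡⟨ ∑V-cong a (λ u → ∑-swap (allVecs b xs) xs _) ⟩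
    ∑V xs a (λ u → ∑ xs (λ x → ∑V xs b (λ w → f (x ∷ u ++ w))))  ≡⟨ ≡-sym (∑V-suc a _) ⟩
    ∑V xs (suc a) (λ u → ∑V xs b (λ w → f (u ++ w)))              ∎
    where open ≡-Reasoning

  ∑V-product : ∀ a b (f : Vec A a → ℕ) (h : Vec A b → ℕ) →
    ∑V xs a (λ u → ∑V xs b (λ w → f u * h w)) ≡ ∑V xs a f * ∑V xs b h
  ∑V-product a b f h = trans (∑V-cong a (λ u → ∑-*ˡ (allVecs b xs) (f u) h)) (∑-*ʳ (allVecs a xs) (∑V xs b h) f)

∑F-without : ∀ m (y : Fin m) (f : Fin m → ℕ) → ∑F m (λ x → 𝟙 (¬? (y ≟ x)) * f x) + f y ≡ ∑F m f
∑F-without (suc m) fzero    f = begin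
  0 + ∑F m (λ x → f (fsuc x) + 0) + f fzero  ≡⟨ cong (λ z → z + f fzero) (∑F-cong m (λ x → +-identityʳ (f (fsuc x)))) ⟩
  ∑F m (f ∘ fsuc) + f fzero                  ≡⟨ +-comm _ (f fzero) ⟩
  f fzero + ∑F m (f ∘ fsuc)                  ∎
  where open ≡-Reasoning
∑F-without (suc m) (fsuc y) f = begin
  f fzero + 0 + rest + f (fsuc y)    ≡⟨ cong (λ z → z + rest + f (fsuc y)) (+-identityʳ (f fzero)) ⟩
  f fzero + rest + f (fsuc y)        ≡⟨ +-assoc (f fzero) rest (f (fsuc y)) ⟩
  f fzero + (rest + f (fsuc y))      ≡⟨ cong (f fzero +_) (∑F-without m y (f ∘ fsuc)) ⟩
  f fzero + ∑F m (f ∘ fsuc)          ∎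
  where
  open ≡-Reasoning
  rest = ∑F m (λ x → 𝟙 (¬? (y ≟ x)) * f (fsuc x))

∑F-select : ∀ m (a : Fin m) p q → ∑F m (λ x → if does (x ≟ a) then p else q) + q ≡ p + m * q
∑F-select (suc m) fzero    p q = begin
  p + ∑F m (λ _ → q) + q  ≡⟨ cong (λ z → p + z + q) (∑F-const m q) ⟩
  p + m * q + q           ≡⟨ +-assoc p (m * q) q ⟩
  p + (m * q + q)         ≡⟨ cong (p +_) (+-comm (m * q) q) ⟩
  p + suc m * q           ∎
  where open ≡-Reasoning
∑F-select (suc m) (fsuc a) p q = begin
  q + rest + q            ≡⟨ +-assoc q rest q ⟩
  q + (rest + q)          ≡⟨ cong (q +_) (∑F-select m a p q) ⟩
  q + (p + m * q)         ≡⟨ x+[y+z]≡y+[x+z] q p (m * q) ⟩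
  p + suc m * q           ∎
  where
  open ≡-Reasoning
  rest = ∑F m (λ x → if does (x ≟ a) then p else q)
  x+[y+z]≡y+[x+z] : ∀ x y z → x + (y + z) ≡ y + (x + z)
  x+[y+z]≡y+[x+z] = solve-∀

fold-step : (s : A → A) (x : A) (d : ℕ) → fold (s x) s d ≡ s (fold x s d)
fold-step s x zero    = refl
fold-step s x (suc d) = cong s (fold-step s x d)

fold-+ : (s : A → A) (x : A) (d e : ℕ) → fold x s (d + e) ≡ fold (fold x s e) s d
fold-+ s x zero    e = refl
fold-+ s x (suc d) e = cong s (fold-+ s x d e)

periodic⇒injective : (s : A → A) (p : ℕ) → (∀ x → fold x s (suc p) ≡ x) → Injective _≡_ _≡_ s
periodic⇒injective s p period {x} {y} sx≡sy = begin
  x                  ≡⟨ ≡-sym (period x) ⟩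
  s (fold x s p)     ≡⟨ ≡-sym (fold-step s x p) ⟩
  fold (s x) s p     ≡⟨ cong (λ z → fold z s p) sx≡sy ⟩
  fold (s y) s p     ≡⟨ fold-step s y p ⟩
  s (fold y s p)     ≡⟨ period y ⟩
  y                  ∎
  where open ≡-Reasoning

Aperiodic : ∀ {n} → (Fin n → Fin n) → ℕ → Set
Aperiodic s g = ∀ d x → 0 < d → d < g → fold x s d ≢ x

rot : ∀ {k} → Fin (suc k) → Fin (suc k)
rot {k} i = suc (toℕ i) mod suc k

module _ {k : ℕ} where

  %-+ˡ : ∀ a b → (a % suc k + b) % suc k ≡ (a + b) % suc k
  %-+ˡ a b = begin
    (a % suc k + b) % suc k                ≡⟨ %-distribˡ-+ (a % suc k) b (suc k) ⟩
    (a % suc k % suc k + b % suc k) % suc k ≡⟨ cong (λ z → (z + b % suc k) % suc k) (m%n%n≡m%n a (suc k)) ⟩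
    (a % suc k + b % suc k) % suc k        ≡⟨ ≡-sym (%-distribˡ-+ a b (suc k)) ⟩
    (a + b) % suc k                        ∎
    where open ≡-Reasoning

  toℕ-mod : ∀ (i : Fin (suc k)) → toℕ i % suc k ≡ toℕ i
  toℕ-mod i = m<n⇒m%n≡m (toℕ<n i)

  toℕ-rot^ : ∀ (i : Fin (suc k)) d → toℕ (fold i rot d) ≡ (toℕ i + d) % suc k
  toℕ-rot^ i zero    = trans (≡-sym (toℕ-mod i)) (cong (_% suc k) (≡-sym (+-identityʳ (toℕ i))))
  toℕ-rot^ i (suc d) = begin
    toℕ (rot (fold i rot d))           ≡⟨ toℕ-fromℕ< _ ⟩
    suc (toℕ (fold i rot d)) % suc k   ≡⟨ cong (λ z → suc z % suc k) (toℕ-rot^ i d) ⟩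
    (1 + (toℕ i + d) % suc k) % suc k  ≡⟨ cong (_% suc k) (+-comm 1 _) ⟩
    ((toℕ i + d) % suc k + 1) % suc k  ≡⟨ %-+ˡ (toℕ i + d) 1 ⟩
    (toℕ i + d + 1) % suc k            ≡⟨ cong (_% suc k) (trans (+-assoc (toℕ i) d 1) (cong (toℕ i +_) (+-comm d 1))) ⟩
    (toℕ i + suc d) % suc k            ∎
    where open ≡-Reasoning

  rot-period : ∀ (i : Fin (suc k)) → fold i rot (suc k) ≡ i
  rot-period i = toℕ-injective (trans (toℕ-rot^ i (suc k)) (trans ([m+n]%n≡m%n (toℕ i) (suc k)) (toℕ-mod i)))

  rot-injective : Injective _≡_ _≡_ (rot {k})
  rot-injective = periodic⇒injective rot k rot-period

  rot-aperiodic : Aperiodic (rot {k}) (suc k)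
  rot-aperiodic d i 0<d (s≤s d≤k) fixed = wraps-or-not (toℕ i + d <? suc k)
    where
    residue : (toℕ i + d) % suc k ≡ toℕ i
    residue = trans (≡-sym (toℕ-rot^ i d)) (cong toℕ fixed)
    wraps-or-not : Dec (toℕ i + d < suc k) → ⊥
    wraps-or-not (yes no-wrap) = <⇒≢ (m<m+n (toℕ i) 0<d) (≡-sym (trans (≡-sym (m<n⇒m%n≡m no-wrap)) residue))
    wraps-or-not (no wrap)     = <⇒≢ (s≤s d≤k) (+-cancelˡ-≡ (toℕ i) d (suc k) i+d≡i+n)
      where
      n≤i+d : suc k ≤ toℕ i + d
      n≤i+d = ≮⇒≥ wrap
      i+d∸n<n : toℕ i + d ∸ suc k < suc k
      i+d∸n<n = m<n+o⇒m∸n<o (toℕ i + d) (suc k) (+-mono-< (toℕ<n i) (s≤s d≤k))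
      i+d∸n≡i : toℕ i + d ∸ suc k ≡ toℕ i
      i+d∸n≡i = trans (≡-sym (m<n⇒m%n≡m i+d∸n<n)) (trans (m≤n⇒[n∸m]%m≡n%m n≤i+d) residue)
      i+d≡i+n : toℕ i + d ≡ toℕ i + suc k
      i+d≡i+n = trans (≡-sym (m∸n+n≡m n≤i+d)) (cong (_+ suc k) i+d∸n≡i)

rot-inject₁ : ∀ {k} (j : Fin k) → rot (inject₁ j) ≡ fsuc j
rot-inject₁ {k} j = toℕ-injective (begin
  toℕ (rot (inject₁ j))          ≡⟨ toℕ-fromℕ< _ ⟩
  suc (toℕ (inject₁ j)) % suc k  ≡⟨ cong (λ z → suc z % suc k) (toℕ-inject₁ j) ⟩
  suc (toℕ j) % suc k            ≡⟨ m<n⇒m%n≡m (s≤s (toℕ<n j)) ⟩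
  suc (toℕ j)                    ∎)
  where open ≡-Reasoning

rot-fromℕ : ∀ k → rot (fromℕ k) ≡ fzero
rot-fromℕ k = toℕ-injective (trans (toℕ-fromℕ< _) (trans (cong (λ z → suc z % suc k) (toℕ-fromℕ k)) (n%n≡0 (suc k))))

last-or-inject₁ : ∀ {k} (i : Fin (suc k)) → i ≡ fromℕ k ⊎ ∃ λ j → i ≡ inject₁ j
last-or-inject₁ {k} i with k ≟ℕ toℕ i
... | yes k≡i = inj₁ (toℕ-injective (trans (≡-sym k≡i) (≡-sym (toℕ-fromℕ k))))
... | no  k≢i = inj₂ (lower₁ i k≢i , ≡-sym (inject₁-lower₁ i k≢i))

cycle-step : ∀ {G k} (C : Cycle G k) (i : Fin (suc k)) → adj G (Cycle.c C i) (Cycle.c C (rot i)) ≡ true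
cycle-step {G} {k} C i with last-or-inject₁ i
... | inj₁ refl       = subst (λ j → adj G (c (fromℕ k)) (c j) ≡ true) (≡-sym (rot-fromℕ k)) close
  where open Cycle C
... | inj₂ (j , refl) = subst (λ j′ → adj G (c (inject₁ j)) (c j′) ≡ true) (≡-sym (rot-inject₁ j)) (step j)
  where open Cycle C


_⊕_ : ∀ {a b} → (Fin a → Fin a) → (Fin b → Fin b) → Fin (a + b) → Fin (a + b)
_⊕_ {a} {b} f h x = [ (λ i → f i ↑ˡ b) , (λ j → a ↑ʳ h j) ]′ (splitAt a x)

_⊞_ : ∀ {a b} → (Fin a → B) → (Fin b → B) → Fin (a + b) → B
_⊞_ {a = a} τ₁ τ₂ x = [ τ₁ , τ₂ ]′ (splitAt a x)

module _ {a b : ℕ} where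

  ↑ˡ-or-↑ʳ : (x : Fin (a + b)) → (∃ λ i → x ≡ i ↑ˡ b) ⊎ (∃ λ j → x ≡ a ↑ʳ j)
  ↑ˡ-or-↑ʳ x with splitAt a x in eq
  ... | inj₁ i = inj₁ (i , trans (≡-sym (join-splitAt a b x)) (cong (join a b) eq))
  ... | inj₂ j = inj₂ (j , trans (≡-sym (join-splitAt a b x)) (cong (join a b) eq))

  ↑ˡ≢↑ʳ : ∀ (i : Fin a) (j : Fin b) → i ↑ˡ b ≢ a ↑ʳ j
  ↑ˡ≢↑ʳ i j same with trans (≡-sym (splitAt-↑ˡ a i b)) (trans (cong (splitAt a) same) (splitAt-↑ʳ a b j))
  ... | ()

  module _ (f : Fin a → Fin a) (h : Fin b → Fin b) where

    ⊕-↑ˡ : ∀ i → (f ⊕ h) (i ↑ˡ b) ≡ f i ↑ˡ b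
    ⊕-↑ˡ i rewrite splitAt-↑ˡ a i b = refl

    ⊕-↑ʳ : ∀ j → (f ⊕ h) (a ↑ʳ j) ≡ a ↑ʳ h j
    ⊕-↑ʳ j rewrite splitAt-↑ʳ a b j = refl

    fold-⊕-↑ˡ : ∀ i d → fold (i ↑ˡ b) (f ⊕ h) d ≡ fold i f d ↑ˡ b
    fold-⊕-↑ˡ i zero    = refl
    fold-⊕-↑ˡ i (suc d) = trans (cong (f ⊕ h) (fold-⊕-↑ˡ i d)) (⊕-↑ˡ _)

    fold-⊕-↑ʳ : ∀ j d → fold (a ↑ʳ j) (f ⊕ h) d ≡ a ↑ʳ fold j h d
    fold-⊕-↑ʳ j zero    = refl
    fold-⊕-↑ʳ j (suc d) = trans (cong (f ⊕ h) (fold-⊕-↑ʳ j d)) (⊕-↑ʳ _)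

    ⊕-injective : Injective _≡_ _≡_ f → Injective _≡_ _≡_ h → Injective _≡_ _≡_ (f ⊕ h)
    ⊕-injective f-inj h-inj {x} {y} same with ↑ˡ-or-↑ʳ x | ↑ˡ-or-↑ʳ y
    ... | inj₁ (i , refl) | inj₁ (i′ , refl) =
      cong (_↑ˡ b) (f-inj (↑ˡ-injective b _ _ (trans (≡-sym (⊕-↑ˡ i)) (trans same (⊕-↑ˡ i′)))))
    ... | inj₁ (i , refl) | inj₂ (j , refl)  = contradiction (trans (≡-sym (⊕-↑ˡ i)) (trans same (⊕-↑ʳ j))) (↑ˡ≢↑ʳ _ _)
    ... | inj₂ (j , refl) | inj₁ (i , refl)  = contradiction (trans (≡-sym (⊕-↑ˡ i)) (trans (≡-sym same) (⊕-↑ʳ j))) (↑ˡ≢↑ʳ _ _)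
    ... | inj₂ (j , refl) | inj₂ (j′ , refl) =
      cong (a ↑ʳ_) (h-inj (↑ʳ-injective a _ _ (trans (≡-sym (⊕-↑ʳ j)) (trans same (⊕-↑ʳ j′)))))

    ⊕-aperiodic : ∀ {g} → Aperiodic f g → Aperiodic h g → Aperiodic (f ⊕ h) g
    ⊕-aperiodic f-ap h-ap d x 0<d d<g returns with ↑ˡ-or-↑ʳ x
    ... | inj₁ (i , refl) = f-ap d i 0<d d<g (↑ˡ-injective b _ _ (trans (≡-sym (fold-⊕-↑ˡ i d)) returns))
    ... | inj₂ (j , refl) = h-ap d j 0<d d<g (↑ʳ-injective a _ _ (trans (≡-sym (fold-⊕-↑ʳ j d)) returns))

  module _ (τ₁ : Fin a → B) (τ₂ : Fin b → B) where

    ⊞-elim : (P : B → Set) → (∀ i → P (τ₁ i)) → (∀ j → P (τ₂ j)) → ∀ x → P ((τ₁ ⊞ τ₂) x)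
    ⊞-elim P P₁ P₂ x with splitAt a x
    ... | inj₁ i = P₁ i
    ... | inj₂ j = P₂ j

    ⊞-↑ˡ : ∀ i → (τ₁ ⊞ τ₂) (i ↑ˡ b) ≡ τ₁ i
    ⊞-↑ˡ i rewrite splitAt-↑ˡ a i b = refl

    ⊞-↑ʳ : ∀ j → (τ₁ ⊞ τ₂) (a ↑ʳ j) ≡ τ₂ j
    ⊞-↑ʳ j rewrite splitAt-↑ʳ a b j = refl

-- Proper colourings of the successor
-- graph of s are the id-twisted ones; other twists give DP-colourings.
Twisted : ∀ {n m} → (Fin n → Fin n) → (Fin n → Fin m → Fin m) → Vec (Fin m) n → Set
Twisted s τ c = ∀ u → lookup c (s u) ≢ τ u (lookup c u)

twisted? : ∀ {n m} s τ (c : Vec (Fin m) n) → Dec (Twisted s τ c)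
twisted? s τ c = all? λ u → ¬? (lookup c (s u) ≟ τ u (lookup c u))

#Twisted : ∀ {n} m → (Fin n → Fin n) → (Fin n → Fin m → Fin m) → ℕ
#Twisted {n} m s τ = ∑V (allFin m) n (𝟙 ∘ twisted? s τ)

≢-cong : {x x′ y y′ : A} → x ≡ x′ → y ≡ y′ → x ≢ y → x′ ≢ y′
≢-cong refl refl x≢y = x≢y

module _ {a b m : ℕ} (f : Fin a → Fin a) (h : Fin b → Fin b)
         (τ₁ : Fin a → Fin m → Fin m) (τ₂ : Fin b → Fin m → Fin m) where

  Twisted-++ : ∀ u w → Twisted (f ⊕ h) (τ₁ ⊞ τ₂) (u ++ w) ⇔ (Twisted f τ₁ u × Twisted h τ₂ w)
  Twisted-++ u w = mk⇔ split join′
    where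
    left : ∀ i → lookup (u ++ w) ((f ⊕ h) (i ↑ˡ b)) ≡ lookup u (f i)
    left i = trans (cong (lookup (u ++ w)) (⊕-↑ˡ f h i)) (lookup-++ˡ u w (f i))
    left′ : ∀ i → (τ₁ ⊞ τ₂) (i ↑ˡ b) (lookup (u ++ w) (i ↑ˡ b)) ≡ τ₁ i (lookup u i)
    left′ i = cong₂ (λ τ x → τ x) (⊞-↑ˡ τ₁ τ₂ i) (lookup-++ˡ u w i)
    right : ∀ j → lookup (u ++ w) ((f ⊕ h) (a ↑ʳ j)) ≡ lookup w (h j)
    right j = trans (cong (lookup (u ++ w)) (⊕-↑ʳ f h j)) (lookup-++ʳ u w (h j))
    right′ : ∀ j → (τ₁ ⊞ τ₂) (a ↑ʳ j) (lookup (u ++ w) (a ↑ʳ j)) ≡ τ₂ j (lookup w j)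
    right′ j = cong₂ (λ τ x → τ x) (⊞-↑ʳ τ₁ τ₂ j) (lookup-++ʳ u w j)

    split : Twisted (f ⊕ h) (τ₁ ⊞ τ₂) (u ++ w) → Twisted f τ₁ u × Twisted h τ₂ w
    split t = (λ i → ≢-cong (left i) (left′ i) (t (i ↑ˡ b)))
            , (λ j → ≢-cong (right j) (right′ j) (t (a ↑ʳ j)))

    join′ : Twisted f τ₁ u × Twisted h τ₂ w → Twisted (f ⊕ h) (τ₁ ⊞ τ₂) (u ++ w)
    join′ (t₁ , t₂) x with ↑ˡ-or-↑ʳ {a} {b} x
    ... | inj₁ (i , refl) = ≢-cong (≡-sym (left i)) (≡-sym (left′ i)) (t₁ i)
    ... | inj₂ (j , refl) = ≢-cong (≡-sym (right j)) (≡-sym (right′ j)) (t₂ j)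

  #Twisted-⊕ : #Twisted m (f ⊕ h) (τ₁ ⊞ τ₂) ≡ #Twisted m f τ₁ * #Twisted m h τ₂
  #Twisted-⊕ = begin
    ∑V colours (a + b) (𝟙 ∘ twisted? (f ⊕ h) (τ₁ ⊞ τ₂))
      ≡⟨ ∑V-++ colours a b _ ⟩
    ∑V colours a (λ u → ∑V colours b (λ w → 𝟙 (twisted? (f ⊕ h) (τ₁ ⊞ τ₂) (u ++ w))))
      ≡⟨ ∑V-cong colours a (λ u → ∑V-cong colours b (λ w → factor u w)) ⟩
    ∑V colours a (λ u → ∑V colours b (λ w → 𝟙 (twisted? f τ₁ u) * 𝟙 (twisted? h τ₂ w)))
      ≡⟨ ∑V-product colours a b _ _ ⟩
    #Twisted m f τ₁ * #Twisted m h τ₂ ∎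
    where
    open ≡-Reasoning
    colours = allFin m
    factor : ∀ u w → 𝟙 (twisted? (f ⊕ h) (τ₁ ⊞ τ₂) (u ++ w)) ≡ 𝟙 (twisted? f τ₁ u) * 𝟙 (twisted? h τ₂ w)
    factor u w = trans (𝟙-⇔ (twisted? (f ⊕ h) (τ₁ ⊞ τ₂) (u ++ w)) (twisted? f τ₁ u ×-dec twisted? h τ₂ w) (Twisted-++ u w)) (𝟙-× (twisted? f τ₁ u) (twisted? h τ₂ w))

atLast : ∀ {k m} → (Fin m → Fin m) → Fin (suc k) → Fin m → Fin m
atLast {k} π i x = if does (i ≟ fromℕ k) then π x else x

module _ {k m : ℕ} (π : Fin m → Fin m) where

  atLast-last : ∀ x → atLast π (fromℕ k) x ≡ π x
  atLast-last x rewrite dec-true (fromℕ k ≟ fromℕ k) refl = refl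

  atLast-inject₁ : ∀ (j : Fin k) x → atLast π (inject₁ j) x ≡ x
  atLast-inject₁ j x rewrite dec-false (inject₁ j ≟ fromℕ k) (fromℕ≢inject₁ ∘ ≡-sym) = refl

  atLast-injective : Injective _≡_ _≡_ π → ∀ i → Injective _≡_ _≡_ (atLast π i)
  atLast-injective π-inj i with does (i ≟ fromℕ k)
  ... | true  = π-inj
  ... | false = λ same → same

atLast-id : ∀ {k m} (i : Fin (suc k)) (x : Fin m) → atLast (λ y → y) i x ≡ x
atLast-id {k} i x with does (i ≟ fromℕ k)
... | true  = refl
... | false = refl

module CycleColourings (m′ : ℕ) where

  m : ℕ
  m = suc (suc m′)

  Colour : Set
  Colour = Fin m

  colours : List Colour
  colours = allFin m

  first last : ∀ {k} → Vec Colour (suc k) → Colour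
  first (x ∷ _)     = x
  last (x ∷ [])     = x
  last (_ ∷ y ∷ v)  = last (y ∷ v)

  PathProper : ∀ {k} → Vec Colour (suc k) → Set
  PathProper (x ∷ [])    = ⊤
  PathProper (x ∷ y ∷ v) = y ≢ x × PathProper (y ∷ v)

  pathProper? : ∀ {k} (v : Vec Colour (suc k)) → Dec (PathProper v)
  pathProper? (x ∷ [])    = yes tt
  pathProper? (x ∷ y ∷ v) = ¬? (y ≟ x) ×-dec pathProper? (y ∷ v)

  PathProper⇔ : ∀ {k} (v : Vec Colour (suc k)) →
    PathProper v ⇔ (∀ (j : Fin k) → lookup v (fsuc j) ≢ lookup v (inject₁ j))
  PathProper⇔ v = mk⇔ (to v) (from v)
    where
    to : ∀ {k} (v : Vec Colour (suc k)) → PathProper v → ∀ j → lookup v (fsuc j) ≢ lookup v (inject₁ j)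
    to (x ∷ y ∷ v) (y≢x , _)  fzero    = y≢x
    to (x ∷ y ∷ v) (_ , rest) (fsuc j) = to (y ∷ v) rest j
    from : ∀ {k} (v : Vec Colour (suc k)) → (∀ j → lookup v (fsuc j) ≢ lookup v (inject₁ j)) → PathProper v
    from (x ∷ [])    _    = tt
    from (x ∷ y ∷ v) diff = diff fzero , from (y ∷ v) (diff ∘ fsuc)

  lookup-last : ∀ {k} (v : Vec Colour (suc k)) → lookup v (fromℕ k) ≡ last v
  lookup-last (x ∷ [])    = refl
  lookup-last (x ∷ y ∷ v) = lookup-last (y ∷ v)

  Twisted-atLast : ∀ {k} (π : Colour → Colour) (v : Vec Colour (suc k)) →
    Twisted rot (atLast π) v ⇔ (PathProper v × first v ≢ π (last v))
  Twisted-atLast {k} π v@(x ∷ _) = mk⇔ to from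
    where
    path-edge : ∀ j → lookup v (rot (inject₁ j)) ≢ atLast π (inject₁ j) (lookup v (inject₁ j)) ⇔ lookup v (fsuc j) ≢ lookup v (inject₁ j)
    path-edge j = mk⇔ (≢-cong (cong (lookup v) (rot-inject₁ j)) (atLast-inject₁ π j _))
                      (≢-cong (cong (lookup v) (≡-sym (rot-inject₁ j))) (≡-sym (atLast-inject₁ π j _)))
    closing : lookup v (rot (fromℕ k)) ≡ x
    closing = cong (lookup v) (rot-fromℕ k)
    closing′ : atLast π (fromℕ k) (lookup v (fromℕ k)) ≡ π (last v)
    closing′ = trans (atLast-last {k} π _) (cong π (lookup-last v))

    to : Twisted rot (atLast π) v → PathProper v × x ≢ π (last v)
    to t = Equivalence.from (PathProper⇔ v) (λ j → Equivalence.to (path-edge j) (t (inject₁ j)))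
         , ≢-cong closing closing′ (t (fromℕ k))
    from : PathProper v × x ≢ π (last v) → Twisted rot (atLast π) v
    from (path , closed) i with last-or-inject₁ i
    ... | inj₁ refl       = ≢-cong (≡-sym closing) (≡-sym closing′) closed
    ... | inj₂ (j , refl) = Equivalence.from (path-edge j) (Equivalence.to (PathProper⇔ v) path j)

  -- Weighting a path
  -- colouring by its first colour x and the target a = π (last colour), with
  -- (p , q) = (0 , 1), counts twisted cycle colourings; prepending a vertex
  -- to the path transforms (p , q) by transfer.
  weight : ℕ × ℕ → Colour → Colour → ℕ
  weight (p , q) a x = if does (x ≟ a) then p else q

  transfer : ℕ × ℕ → ℕ × ℕ
  transfer (p , q) = (suc m′ * q , p + m′ * q)

  transfer-step : ∀ pq a y → ∑F m (λ x → 𝟙 (¬? (y ≟ x)) * weight pq a x) ≡ weight (transfer pq) a y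
  transfer-step (p , q) a y = +-cancelʳ-≡ (weight (p , q) a y) _ _ (trans (∑F-without m y (weight (p , q) a)) (by-cases (y ≟ a)))
    where
    -- Remove the term at y from the total p + (m - 1) q of all weights.
    total : ∑F m (weight (p , q) a) + q ≡ p + m * q
    total = ∑F-select m a p q
    by-cases : (y≟a : Dec (y ≡ a)) →
      ∑F m (weight (p , q) a) ≡ (if does y≟a then suc m′ * q else p + m′ * q) + (if does y≟a then p else q)
    by-cases (yes _) = +-cancelʳ-≡ q _ _ (trans total (arithmetic m′ p q))
      where
      arithmetic : ∀ m′ p q → p + suc (suc m′) * q ≡ suc m′ * q + p + q
      arithmetic = solve-∀
    by-cases (no _) = +-cancelʳ-≡ q _ _ (trans total (arithmetic m′ p q))
      where
      arithmetic : ∀ m′ p q → p + suc (suc m′) * q ≡ p + m′ * q + q + q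
      arithmetic = solve-∀

  pathWeight : (Colour → Colour) → ℕ × ℕ → ∀ {k} → Vec Colour (suc k) → ℕ
  pathWeight π pq v = 𝟙 (pathProper? v) * weight pq (π (last v)) (first v)

  peel : ∀ π pq {k} (y : Colour) (v : Vec Colour k) →
    ∑ colours (λ x → pathWeight π pq (x ∷ y ∷ v)) ≡ pathWeight π (transfer pq) (y ∷ v)
  peel π pq y v = begin
    ∑ colours (λ x → 𝟙 (¬? (y ≟ x) ×-dec path?) * w x)
      ≡⟨ ∑-cong colours (λ x → trans (cong (_* w x) (𝟙-× (¬? (y ≟ x)) path?)) (swap (𝟙 (¬? (y ≟ x))) (𝟙 path?) (w x))) ⟩
    ∑ colours (λ x → 𝟙 path? * (𝟙 (¬? (y ≟ x)) * w x))
      ≡⟨ ∑-*ˡ colours (𝟙 path?) _ ⟩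
    𝟙 path? * ∑ colours (λ x → 𝟙 (¬? (y ≟ x)) * w x)
      ≡⟨ cong (𝟙 path? *_) (trans (∑-allFin m (λ x → 𝟙 (¬? (y ≟ x)) * w x)) (transfer-step pq a y)) ⟩
    𝟙 path? * weight (transfer pq) a y ∎
    where
    open ≡-Reasoning
    path? = pathProper? (y ∷ v)
    a = π (last (y ∷ v))
    w = weight pq a
    swap : ∀ i j c → i * j * c ≡ j * (i * c)
    swap = solve-∀

  ∑pathWeight : ∀ π k pq → ∑V colours (suc k) (pathWeight π pq) ≡ ∑F m (λ x → weight (fold pq transfer k) (π x) x)
  ∑pathWeight π zero pq = begin
    ∑V colours 1 (pathWeight π pq)               ≡⟨ ∑V-suc colours 0 (pathWeight π pq) ⟩
    ∑ colours (λ x → weight pq (π x) x + 0) + 0  ≡⟨ +-identityʳ _ ⟩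
    ∑ colours (λ x → weight pq (π x) x + 0)      ≡⟨ ∑-cong colours (λ x → +-identityʳ (weight pq (π x) x)) ⟩
    ∑ colours (λ x → weight pq (π x) x)          ≡⟨ ∑-allFin m (λ x → weight pq (π x) x) ⟩
    ∑F m (λ x → weight pq (π x) x)               ∎
    where open ≡-Reasoning
  ∑pathWeight π (suc k) pq = begin
    ∑V colours (suc (suc k)) (pathWeight π pq)                       ≡⟨ ∑V-suc colours (suc k) (pathWeight π pq) ⟩
    ∑V colours (suc k) (λ v → ∑ colours (λ x → pathWeight π pq (x ∷ v))) ≡⟨ ∑V-cong colours (suc k) (λ { (y ∷ v) → peel π pq y v }) ⟩
    ∑V colours (suc k) (pathWeight π (transfer pq))                  ≡⟨ ∑pathWeight π k (transfer pq) ⟩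
    ∑F m (λ x → weight (fold (transfer pq) transfer k) (π x) x)       ≡⟨ cong (λ r → ∑F m (λ x → weight r (π x) x)) (fold-step transfer pq k) ⟩
    ∑F m (λ x → weight (fold pq transfer (suc k)) (π x) x)           ∎
    where open ≡-Reasoning

  -- P k (resp. Q k) is the number of proper colourings of a path on k + 1
  -- vertices with prescribed first colour whose last colour avoids the first
  -- (resp. avoids a prescribed other colour).
  P Q : ℕ → ℕ
  P k = proj₁ (fold (0 , 1) transfer k)
  Q k = proj₂ (fold (0 , 1) transfer k)

  #Twisted-atLast : ∀ k π → #Twisted m rot (atLast {k} π) ≡ ∑F m (λ x → weight (fold (0 , 1) transfer k) (π x) x)
  #Twisted-atLast k π = trans (∑V-cong colours (suc k) count-one) (∑pathWeight π k (0 , 1))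
    where
    avoid : ∀ x a → 𝟙 (¬? (x ≟ a)) ≡ weight (0 , 1) a x
    avoid x a with does (x ≟ a)
    ... | true  = refl
    ... | false = refl
    count-one : ∀ v → 𝟙 (twisted? rot (atLast π) v) ≡ pathWeight π (0 , 1) v
    count-one v = begin
      𝟙 (twisted? rot (atLast π) v)                            ≡⟨ 𝟙-⇔ (twisted? rot (atLast π) v) (pathProper? v ×-dec ¬? (first v ≟ π (last v))) (Twisted-atLast π v) ⟩
      𝟙 (pathProper? v ×-dec ¬? (first v ≟ π (last v)))        ≡⟨ 𝟙-× (pathProper? v) (¬? (first v ≟ π (last v))) ⟩
      𝟙 (pathProper? v) * 𝟙 (¬? (first v ≟ π (last v)))        ≡⟨ cong (𝟙 (pathProper? v) *_) (avoid (first v) (π (last v))) ⟩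
      pathWeight π (0 , 1) v                                   ∎
      where open ≡-Reasoning

  #Twisted-untwisted : ∀ k → #Twisted m rot (atLast {k} (λ x → x)) ≡ m * P k
  #Twisted-untwisted k = trans (#Twisted-atLast k (λ x → x))
    (trans (∑F-cong m (λ x → cong (λ b → if b then P k else Q k) (dec-true (x ≟ x) refl))) (∑F-const m (P k)))

  #Twisted-deranged : ∀ k π → (∀ x → π x ≢ x) → #Twisted m rot (atLast {k} π) ≡ m * Q k
  #Twisted-deranged k π deranged = trans (#Twisted-atLast k π)
    (trans (∑F-cong m (λ x → cong (λ b → if b then P k else Q k) (dec-false (x ≟ π x) (deranged x ∘ ≡-sym)))) (∑F-const m (Q k)))

  -- P k and Q k differ by one: P is behind for even k and ahead for odd k.
  Behind Ahead : ℕ × ℕ → Set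
  Behind (p , q) = p + 1 ≡ q
  Ahead  (p , q) = p ≡ q + 1

  transfer-Behind : ∀ pq → Behind pq → Ahead (transfer pq)
  transfer-Behind (p , .(p + 1)) refl = arithmetic m′ p
    where
    arithmetic : ∀ m′ p → suc m′ * (p + 1) ≡ p + m′ * (p + 1) + 1
    arithmetic = solve-∀

  transfer-Ahead : ∀ pq → Ahead pq → Behind (transfer pq)
  transfer-Ahead (.(q + 1) , q) refl = arithmetic m′ q
    where
    arithmetic : ∀ m′ q → suc m′ * q + 1 ≡ q + 1 + m′ * q
    arithmetic = solve-∀

  Behind-even : ∀ t → Behind (fold (0 , 1) transfer (t * 2))
  Behind-even zero    = refl
  Behind-even (suc t) = transfer-Ahead _ (transfer-Behind _ (Behind-even t))

  Q<P-odd : ∀ t → Q (suc (t * 2)) < P (suc (t * 2))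
  Q<P-odd t = ≤-reflexive (trans (+-comm 1 _) (≡-sym (transfer-Behind _ (Behind-even t))))

  -- With at least three colours there is some such colouring.
  Q-positive : 1 ≤ m′ → ∀ k → 1 ≤ Q k
  Q-positive 1≤m′ zero    = ≤-refl
  Q-positive 1≤m′ (suc k) = ≤-trans (*-mono-≤ 1≤m′ (Q-positive 1≤m′ k)) (m≤n+m (m′ * Q k) (P k))

  P-positive : 1 ≤ m′ → ∀ k → 0 < k → 1 ≤ P k
  P-positive 1≤m′ (suc k) _ = ≤-trans (Q-positive 1≤m′ k) (m≤m+n (Q k) (m′ * Q k))

-- A subset of V(H) = Fin n × Fin m is a
-- Boolean table with one row per vertex; an H-colouring has exactly one true
-- entry per row, so it is the encoding of a colour vector c, and it is
-- independent in H exactly when c is.  Sums over tables therefore reduce to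
-- sums over colour vectors.
bools : List Bool
bools = true ∷ false ∷ []

oneHot : ∀ {m} → Fin m → Vec Bool m
oneHot {suc m} fzero = true ∷ replicate m false
oneHot (fsuc x)      = false ∷ oneHot x

encode : ∀ {m k} → Vec (Fin m) k → Vec (Vec Bool m) k
encode = Data.Vec.map oneHot

zeros? : ∀ {k} (v : Vec Bool k) → Dec (v ≡ replicate k false)
zeros? v = ≡-dec _≟B_ v (replicate _ false)

-- φ r h is h at the true entry of a one-hot row r, and 0 if r is not one-hot.
φ : ∀ {k} → Vec Bool k → (Fin k → ℕ) → ℕ
φ []          h = 0
φ (true ∷ v)  h = 𝟙 (zeros? v) * h fzero
φ (false ∷ v) h = φ v (h ∘ fsuc)

φ-cong : ∀ {k} (r : Vec Bool k) {h h′ : Fin k → ℕ} → (∀ x → h x ≡ h′ x) → φ r h ≡ φ r h′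
φ-cong []          h≗h′ = refl
φ-cong (true ∷ v)  h≗h′ = cong (𝟙 (zeros? v) *_) (h≗h′ fzero)
φ-cong (false ∷ v) h≗h′ = φ-cong v (h≗h′ ∘ fsuc)

φ-∑ : ∀ {k} (r : Vec Bool k) (xs : List A) (g : A → Fin k → ℕ) → φ r (λ x → ∑ xs (λ a → g a x)) ≡ ∑ xs (λ a → φ r (g a))
φ-∑ []          xs g = ≡-sym (∑-zero xs)
φ-∑ (true ∷ v)  xs g = ≡-sym (∑-*ˡ xs (𝟙 (zeros? v)) (λ a → g a fzero))
φ-∑ (false ∷ v) xs g = φ-∑ v xs (λ a → g a ∘ fsuc)

φ-oneHot : ∀ {k} (x : Fin k) (h : Fin k → ℕ) → φ (oneHot x) h ≡ h x
φ-oneHot {suc k} fzero h = trans (cong (_* h fzero) (𝟙-yes (zeros? (replicate k false)) refl)) (+-identityʳ (h fzero))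
φ-oneHot (fsuc x) h = φ-oneHot x (h ∘ fsuc)

φ-nonzero : ∀ {k} (r : Vec Bool k) (h : Fin k → ℕ) → φ r h ≢ 0 → ∃ λ x → r ≡ oneHot x
φ-nonzero []          h nonzero = contradiction refl nonzero
φ-nonzero (true ∷ v)  h nonzero with zeros? v
... | yes refl = fzero , refl
... | no _     = contradiction refl nonzero
φ-nonzero (false ∷ v) h nonzero with φ-nonzero v (h ∘ fsuc) nonzero
... | x , refl = fsuc x , refl

∑zeros : ∀ k → ∑V bools k (𝟙 ∘ zeros?) ≡ 1
∑zeros zero    = refl
∑zeros (suc k) = trans (∑V-suc bools k (𝟙 ∘ zeros?)) (trans (∑V-cong bools k (λ v → +-identityʳ (𝟙 (zeros? v)))) (∑zeros k))

-- Summing φ r h over all rows r picks up each h x once, from oneHot x.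
∑φ : ∀ k (h : Fin k → ℕ) → ∑V bools k (λ r → φ r h) ≡ ∑F k h
∑φ zero    h = refl
∑φ (suc k) h = begin
  ∑V bools (suc k) (λ r → φ r h)                                    ≡⟨ ∑V-suc bools k (λ r → φ r h) ⟩
  ∑V bools k (λ v → 𝟙 (zeros? v) * h fzero + (φ v (h ∘ fsuc) + 0)) ≡⟨ ∑V-cong bools k (λ v → cong (𝟙 (zeros? v) * h fzero +_) (+-identityʳ _)) ⟩
  ∑V bools k (λ v → 𝟙 (zeros? v) * h fzero + φ v (h ∘ fsuc))        ≡⟨ ∑-+ (allVecs k bools) _ _ ⟩
  ∑V bools k (λ v → 𝟙 (zeros? v) * h fzero) + ∑V bools k (λ v → φ v (h ∘ fsuc))
    ≡⟨ cong₂ _+_ (trans (∑-*ʳ (allVecs k bools) (h fzero) (𝟙 ∘ zeros?)) (cong (_* h fzero) (∑zeros k))) (∑φ k (h ∘ fsuc)) ⟩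
  1 * h fzero + ∑F k (h ∘ fsuc)                                     ≡⟨ cong (_+ ∑F k (h ∘ fsuc)) (*-identityˡ (h fzero)) ⟩
  ∑F (suc k) h                                                      ∎
  where open ≡-Reasoning

-- Φ S f is f at the colour vector encoded by the table S, and 0 if S is not an encoding.
Φ : ∀ {m k} → Vec (Vec Bool m) k → (Vec (Fin m) k → ℕ) → ℕ
Φ []      f = f []
Φ (r ∷ S) f = Φ S (λ c → φ r (λ x → f (x ∷ c)))

Φ-cong : ∀ {m k} (S : Vec (Vec Bool m) k) {f f′ : Vec (Fin m) k → ℕ} → (∀ c → f c ≡ f′ c) → Φ S f ≡ Φ S f′
Φ-cong []      f≗f′ = f≗f′ []
Φ-cong (r ∷ S) f≗f′ = Φ-cong S (λ c → φ-cong r (λ x → f≗f′ (x ∷ c)))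

Φ-∑ : ∀ {m k} (S : Vec (Vec Bool m) k) (xs : List A) (g : A → Vec (Fin m) k → ℕ) →
  Φ S (λ c → ∑ xs (λ a → g a c)) ≡ ∑ xs (λ a → Φ S (g a))
Φ-∑ []      xs g = refl
Φ-∑ (r ∷ S) xs g = trans (Φ-cong S (λ c → φ-∑ r xs (λ a x → g a (x ∷ c)))) (Φ-∑ S xs (λ a c → φ r (λ x → g a (x ∷ c))))

Φ-encode : ∀ {m k} (c : Vec (Fin m) k) (f : Vec (Fin m) k → ℕ) → Φ (encode c) f ≡ f c
Φ-encode []      f = refl
Φ-encode (x ∷ c) f = trans (Φ-encode c _) (φ-oneHot x _)

Φ-nonzero : ∀ {m k} (S : Vec (Vec Bool m) k) (f : Vec (Fin m) k → ℕ) → Φ S f ≢ 0 → ∃ λ c → S ≡ encode c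
Φ-nonzero []      f nonzero = [] , refl
Φ-nonzero (r ∷ S) f nonzero with Φ-nonzero S _ nonzero
... | c , refl with φ-nonzero r (λ x → f (x ∷ c)) (λ zero → nonzero (trans (Φ-encode c _) zero))
... | x , refl = x ∷ c , refl

∑Φ : ∀ m k (f : Vec (Fin m) k → ℕ) → ∑V (allVecs m bools) k (λ S → Φ S f) ≡ ∑V (allFin m) k f
∑Φ m zero    f = refl
∑Φ m (suc k) f = begin
  ∑V rows (suc k) (λ S → Φ S f)                                          ≡⟨ ∑V-suc rows k (λ S → Φ S f) ⟩
  ∑V rows k (λ S → ∑ rows (λ r → Φ S (λ c → φ r (λ x → f (x ∷ c)))))    ≡⟨ ∑V-cong rows k (λ S → ≡-sym (Φ-∑ S rows (λ r c → φ r (λ x → f (x ∷ c))))) ⟩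
  ∑V rows k (λ S → Φ S (λ c → ∑ rows (λ r → φ r (λ x → f (x ∷ c)))))    ≡⟨ ∑V-cong rows k (λ S → Φ-cong S (λ c → trans (∑φ m _) (≡-sym (∑-allFin m _)))) ⟩
  ∑V rows k (λ S → Φ S (λ c → ∑ (allFin m) (λ x → f (x ∷ c))))           ≡⟨ ∑Φ m k _ ⟩
  ∑V (allFin m) k (λ c → ∑ (allFin m) (λ x → f (x ∷ c)))                 ≡⟨ ≡-sym (∑V-suc (allFin m) k f) ⟩
  ∑V (allFin m) (suc k) f                                                ∎
  where
  open ≡-Reasoning
  rows = allVecs m bools

trues : ∀ {m} → Vec Bool m → ℕ
trues = count (_≟B true)

trues-oneHot : ∀ {m} (x : Fin m) → trues (oneHot x) ≡ 1
trues-oneHot {suc m} fzero = cong suc (no-trues m)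
  where
  no-trues : ∀ m → trues (replicate m false) ≡ 0
  no-trues zero    = refl
  no-trues (suc m) = no-trues m
trues-oneHot (fsuc x) = trues-oneHot x

trues≡1 : ∀ {m} (r : Vec Bool m) → trues r ≡ 1 → ∃ λ x → r ≡ oneHot x
trues≡1 (true ∷ v)  one = fzero , cong (true ∷_) (trues≡0 v (suc-injective one))
  where
  trues≡0 : ∀ {m} (v : Vec Bool m) → trues v ≡ 0 → v ≡ replicate m false
  trues≡0 []          _    = refl
  trues≡0 (false ∷ v) none = cong (false ∷_) (trues≡0 v none)
trues≡1 (false ∷ v) one with trues≡1 v one
... | x , refl = fsuc x , refl

trues≤1 : ∀ {m} (r : Vec Bool m) → (∀ i j → lookup r i ≡ true → lookup r j ≡ true → i ≡ j) → trues r ≤ 1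
trues≤1 []          _      = z≤n
trues≤1 (true ∷ v)  unique = s≤s (≤-reflexive (none v (λ j hit → 0≢suc (unique fzero (fsuc j) refl hit))))
  where
  0≢suc : ∀ {m} {j : Fin m} → fzero ≢ fsuc j
  0≢suc ()
  none : ∀ {m} (v : Vec Bool m) → (∀ j → lookup v j ≢ true) → trues v ≡ 0
  none []          _     = refl
  none (true ∷ v)  ¬true = contradiction refl (¬true fzero)
  none (false ∷ v) ¬true = none v (¬true ∘ fsuc)
trues≤1 (false ∷ v) unique = trues≤1 v (λ i j i-hit j-hit → fsuc-injective (unique (fsuc i) (fsuc j) i-hit j-hit))

size≤ : ∀ {m k} (S : Vec (Vec Bool m) k) → (∀ u → trues (lookup S u) ≤ 1) → size S ≤ k
size≤ []      _     = z≤n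
size≤ (r ∷ S) rows≤1 = +-mono-≤ (rows≤1 fzero) (size≤ S (rows≤1 ∘ fsuc))

decode : ∀ {m k} (S : Vec (Vec Bool m) k) → (∀ u → trues (lookup S u) ≤ 1) → size S ≡ k → ∃ λ c → S ≡ encode c
decode []      _     _     = [] , refl
decode (r ∷ S) rows≤1 total with trues r in eq
... | zero              = contradiction (size≤ S (rows≤1 ∘ fsuc)) (<⇒≱ (≤-reflexive (≡-sym total)))
... | suc (suc _)       = contradiction (subst (_≤ 1) eq (rows≤1 fzero)) λ { (s≤s ()) }
... | suc zero with trues≡1 r eq | decode S (rows≤1 ∘ fsuc) (suc-injective total)
...   | x , refl | c , refl = x ∷ c , refl

lookup-oneHot : ∀ {m} (x i : Fin m) → lookup (oneHot x) i ≡ true ⇔ x ≡ i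
lookup-oneHot x i = mk⇔ (to x i) (λ { refl → self x })
  where
  to : ∀ {m} (x i : Fin m) → lookup (oneHot x) i ≡ true → x ≡ i
  to fzero    fzero    _   = refl
  to {suc m} fzero (fsuc i) hit = contradiction (trans (≡-sym (lookup-replicate i false)) hit) λ ()
  to (fsuc x) (fsuc i) hit = cong fsuc (to x i hit)
  self : ∀ {m} (x : Fin m) → lookup (oneHot x) x ≡ true
  self fzero    = refl
  self (fsuc x) = self x

module _ {G : Graph} {m : ℕ} (H : Cover G m) where

  Independent-colouring : Vec (Fin m) (n G) → Set
  Independent-colouring c = ∀ u v → hadj H u (lookup c u) v (lookup c v) ≡ false

  independent-colouring? : ∀ c → Dec (Independent-colouring c)
  independent-colouring? c = all? λ u → all? λ v → hadj H u (lookup c u) v (lookup c v) ≟B false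

  ∈-encode : ∀ (c : Vec (Fin m) (n G)) u i → (u , i) ∈S encode c ⇔ lookup c u ≡ i
  ∈-encode c u i = subst (λ r → (lookup r i ≡ true) ⇔ (lookup c u ≡ i)) (≡-sym (lookup-map u oneHot c)) (lookup-oneHot (lookup c u) i)

  HColoring-encode : ∀ c → IsHColoring H (encode c) ⇔ Independent-colouring c
  HColoring-encode c = mk⇔
    (λ (independent , _) u v → independent u _ v _ (Equivalence.from (∈-encode c u _) refl) (Equivalence.from (∈-encode c v _) refl))
    (λ independent → (λ u i v j u∈ v∈ → subst₂ (λ i j → hadj H u i v j ≡ false)
                         (Equivalence.to (∈-encode c u i) u∈) (Equivalence.to (∈-encode c v j) v∈) (independent u v))
                     , size-encode c)
    where
    size-encode : ∀ {k} (c : Vec (Fin m) k) → size (encode c) ≡ k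
    size-encode []      = refl
    size-encode (x ∷ c) = cong₂ _+_ (trues-oneHot x) (size-encode c)

  -- Since each L(u) is a clique, an H-colouring picks one point per vertex.
  HColoring-decode : ∀ S → IsHColoring H S → ∃ λ c → S ≡ encode c
  HColoring-decode S (independent , total) = decode S (λ u → at-most-one u) total
    where
    at-most-one : ∀ u → trues (lookup S u) ≤ 1
    at-most-one u = trues≤1 (lookup S u) unique
      where
      unique : ∀ i j → (u , i) ∈S S → (u , j) ∈S S → i ≡ j
      unique i j i∈ j∈ with i ≟ j
      ... | yes i≡j = i≡j
      ... | no  i≢j = contradiction (trans (≡-sym (clique H u i j i≢j)) (independent u i u j i∈ j∈)) λ ()

  private
    f : Vec (Fin m) (n G) → ℕ
    f = 𝟙 ∘ independent-colouring?

    at-encoding : ∀ c → 𝟙 (isHColoring? H (encode c)) ≡ Φ (encode c) f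
    at-encoding c = trans (𝟙-⇔ (isHColoring? H (encode c)) (independent-colouring? c) (HColoring-encode c)) (≡-sym (Φ-encode c f))

  -- The indicator of being an H-colouring is Φ of the indicator of
  -- independence: both vanish away from encodings and agree on them.
  𝟙-HColoring : ∀ S → 𝟙 (isHColoring? H S) ≡ Φ S f
  𝟙-HColoring S with Φ S f ≟ℕ 0
  ... | no nonzero with Φ-nonzero S f nonzero
  ...   | c , refl = at-encoding c
  𝟙-HColoring S | yes vanishes = trans (𝟙-no (isHColoring? H S) not-colouring) (≡-sym vanishes)
    where
    not-colouring : ¬ IsHColoring H S
    not-colouring hc with HColoring-decode S hc
    ... | c , refl = contradiction (trans (≡-sym (𝟙-yes (isHColoring? H (encode c)) hc)) (trans (at-encoding c) vanishes)) λ ()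

  dpCount≡#independent : dpCount H ≡ ∑V (allFin m) (n G) (𝟙 ∘ independent-colouring?)
  dpCount≡#independent = trans (countL≡∑𝟙 (isHColoring? H) tables) (trans (∑-cong tables 𝟙-HColoring) (∑Φ m (n G) f))
    where
    tables = allVecs (n G) (allVecs m bools)
minimum : (f : A → ℕ) → (∀ j → Dec (∃ λ x → f x ≤ j)) → A →
          Σ ℕ λ v → (∃ λ x → f x ≡ v) × (∀ x → v ≤ f x)
minimum f below? x₀ = descend (f x₀) (x₀ , ≤-refl)
  where
  descend : ∀ j → (∃ λ x → f x ≤ j) → Σ ℕ λ v → (∃ λ x → f x ≡ v) × (∀ x → v ≤ f x)
  descend zero    (x , fx≤0) = 0 , (x , n≤0⇒n≡0 fx≤0) , λ _ → z≤n
  descend (suc j) (x , fx≤j+1) with below? j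
  ... | yes lower = descend j lower
  ... | no  none  = suc j , (x , ≤-antisym fx≤j+1 (above x)) , above
    where
    above : ∀ y → suc j ≤ f y
    above y = ≰⇒> (λ fy≤j → none (y , fy≤j))

Searchable : Set → Set₁
Searchable X = ∀ (P : X → Set) → (∀ x → Dec (P x)) → Dec (∃ P)

search-Bool : Searchable Bool
search-Bool P P? with P? true | P? false
... | yes p | _     = yes (true , p)
... | no _  | yes p = yes (false , p)
... | no ¬t | no ¬f = no λ { (true , p) → ¬t p ; (false , p) → ¬f p }

search-Vec : Searchable A → ∀ k → Searchable (Vec A k)
search-Vec search-A zero P P? with P? []
... | yes p = yes ([] , p)
... | no ¬p = no λ { ([] , p) → ¬p p }
search-Vec search-A (suc k) P P? with search-A (λ x → ∃ λ v → P (x ∷ v)) (λ x → search-Vec search-A k (P ∘ (x ∷_)) (P? ∘ (x ∷_)))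
... | yes (x , v , p) = yes (x ∷ v , p)
... | no ¬p           = no λ { (x ∷ v , p) → ¬p (x , v , p) }

-- Covers of G are determined by finite Boolean tables, so P_DP(G, m), the
-- least number of H-colourings over all m-fold covers H, is attained.
module CoverSearch (G : Graph) (m : ℕ) where

  private
    k = n G

  Adjacency : Set
  Adjacency = Fin k → Fin m → Fin k → Fin m → Bool

  Table : Set
  Table = Vec (Vec (Vec (Vec Bool m) k) m) k

  entry : Table → Adjacency
  entry T u i v j = lookup (lookup (lookup (lookup T u) i) v) j

  table : Adjacency → Table
  table h = Data.Vec.tabulate λ u → Data.Vec.tabulate λ i → Data.Vec.tabulate λ v → Data.Vec.tabulate λ j → h u i v j

  entry-table : ∀ h u i v j → entry (table h) u i v j ≡ h u i v j
  entry-table h u i v j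
    rewrite lookup∘tabulate (λ u → Data.Vec.tabulate λ i → Data.Vec.tabulate λ v → Data.Vec.tabulate λ j → h u i v j) u
          | lookup∘tabulate (λ i → Data.Vec.tabulate λ v → Data.Vec.tabulate λ j → h u i v j) i
          | lookup∘tabulate (λ v → Data.Vec.tabulate λ j → h u i v j) v
          | lookup∘tabulate (λ j → h u i v j) j = refl

  IsCover : Adjacency → Set
  IsCover h = (∀ u i v j → h u i v j ≡ h v j u i)
            × (∀ u i → h u i u i ≡ false)
            × (∀ u i j → i ≢ j → h u i u j ≡ true)
            × (∀ u i v j → h u i v j ≡ true → u ≡ v ⊎ adj G u v ≡ true)
            × (∀ u v → adj G u v ≡ true →
                 (∀ i j j′ → h u i v j ≡ true → h u i v j′ ≡ true → j ≡ j′) ×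
                 (∀ i i′ j → h u i v j ≡ true → h u i′ v j ≡ true → i ≡ i′))

  isCover? : ∀ h → Dec (IsCover h)
  isCover? h =
    (all? λ u → all? λ i → all? λ v → all? λ j → h u i v j ≟B h v j u i)
    ×-dec (all? λ u → all? λ i → h u i u i ≟B false)
    ×-dec (all? λ u → all? λ i → all? λ j → ¬? (i ≟ j) →-dec (h u i u j ≟B true))
    ×-dec (all? λ u → all? λ i → all? λ v → all? λ j → (h u i v j ≟B true) →-dec ((u ≟ v) ⊎-dec (adj G u v ≟B true)))
    ×-dec (all? λ u → all? λ v → (adj G u v ≟B true) →-dec
             ((all? λ i → all? λ j → all? λ j′ → (h u i v j ≟B true) →-dec ((h u i v j′ ≟B true) →-dec (j ≟ j′)))
              ×-dec (all? λ i → all? λ i′ → all? λ j → (h u i v j ≟B true) →-dec ((h u i′ v j ≟B true) →-dec (i ≟ i′)))))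

  toCover : ∀ {h} → IsCover h → Cover G m
  toCover {h} (hsym , hirrefl , clique , edgeOnly , matching) = record
    { hadj = h ; hsym = hsym ; hirrefl = hirrefl ; clique = clique ; edgeOnly = edgeOnly ; matching = matching }

  fromCover : (H : Cover G m) → IsCover (entry (table (hadj H)))
  fromCover H =
      (λ u i v j → trans (E u i v j) (trans (hsym H u i v j) (≡-sym (E v j u i))))
    , (λ u i → trans (E u i u i) (hirrefl H u i))
    , (λ u i j i≢j → trans (E u i u j) (clique H u i j i≢j))
    , (λ u i v j e → edgeOnly H u i v j (trans (≡-sym (E u i v j)) e))
    , (λ u v uv → (λ i j j′ e e′ → proj₁ (matching H u v uv) i j j′ (trans (≡-sym (E u i v j)) e) (trans (≡-sym (E u i v j′)) e′))
                , (λ i i′ j e e′ → proj₂ (matching H u v uv) i i′ j (trans (≡-sym (E u i v j)) e) (trans (≡-sym (E u i′ v j)) e′)))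
    where
    E = entry-table (hadj H)

  dpCount-cong : (H H′ : Cover G m) → (∀ u i v j → hadj H u i v j ≡ hadj H′ u i v j) → dpCount H ≡ dpCount H′
  dpCount-cong H H′ same = trans (countL≡∑𝟙 (isHColoring? H) tables)
    (trans (∑-cong tables (λ S → 𝟙-⇔ (isHColoring? H S) (isHColoring? H′ S) (mk⇔ (transport H H′ same S) (transport H′ H (λ u i v j → ≡-sym (same u i v j)) S))))
           (≡-sym (countL≡∑𝟙 (isHColoring? H′) tables)))
    where
    tables = allVecs (n G) (allVecs m bools)
    transport : (H H′ : Cover G m) → (∀ u i v j → hadj H u i v j ≡ hadj H′ u i v j) → ∀ S → IsHColoring H S → IsHColoring H′ S
    transport H H′ same S (independent , total) = (λ u i v j u∈ v∈ → trans (≡-sym (same u i v j)) (independent u i v j u∈ v∈)) , total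

  cover-below? : ∀ j → Dec (∃ λ (H : Cover G m) → dpCount H ≤ j)
  cover-below? j with search-Vec (search-Vec (search-Vec (search-Vec search-Bool m) k) m) k CoverBelow coverBelow?
    where
    CoverBelow : Table → Set
    CoverBelow T = Σ (IsCover (entry T)) λ c → dpCount (toCover c) ≤ j
    coverBelow? : ∀ T → Dec (CoverBelow T)
    coverBelow? T with isCover? (entry T)
    ... | no ¬c = no λ (c , _) → ¬c c
    ... | yes c with dpCount (toCover c) ≤? j
    ...   | yes le = yes (c , le)
    ...   | no  ¬le = no λ (c′ , le) → ¬le (subst (_≤ j) (dpCount-cong (toCover c′) (toCover c) (λ _ _ _ _ → refl)) le)
  ... | yes (T , c , le) = yes (toCover c , le)
  ... | no none = no λ (H , le) → none (table (hadj H) , fromCover H ,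
                    subst (_≤ j) (dpCount-cong H (toCover (fromCover H)) (λ u i v j → ≡-sym (entry-table (hadj H) u i v j))) le)

  dpChromatic : (H₀ : Cover G m) → Σ ℕ λ v → IsDPChromaticValue G m v × v ≤ dpCount H₀
  dpChromatic H₀ with minimum dpCount cover-below? H₀
  ... | v , (H , dpH≡v) , least = v , ((H , dpH≡v) , least) , least H₀

-- The graph of an injective successor map s on Fin n: u and v are adjacent
-- when one is the image of the other, so every vertex lies on the cycle
-- formed by its s-orbit.
module SuccessorGraph {n : ℕ} (s : Fin n → Fin n) (s-injective : Injective _≡_ _≡_ s)
                      (k : ℕ) (2≤k : 2 ≤ k) (aperiodic : Aperiodic s (suc k)) where

  Adjacent : Fin n → Fin n → Set
  Adjacent u v = v ≡ s u ⊎ u ≡ s v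

  adjacent? : ∀ u v → Dec (Adjacent u v)
  adjacent? u v = (v ≟ s u) ⊎-dec (u ≟ s v)

  s-moves : ∀ x → s x ≢ x
  s-moves x = aperiodic 1 x (s≤s z≤n) (s≤s (≤-trans (s≤s z≤n) 2≤k))

  s²-moves : ∀ x → s (s x) ≢ x
  s²-moves x = aperiodic 2 x (s≤s z≤n) (s≤s 2≤k)

  Adjacent-sym : ∀ {u v} → Adjacent u v → Adjacent v u
  Adjacent-sym (inj₁ v≡su) = inj₂ v≡su
  Adjacent-sym (inj₂ u≡sv) = inj₁ u≡sv

  Adjacent-irrefl : ∀ u → ¬ Adjacent u u
  Adjacent-irrefl u (inj₁ u≡su) = s-moves u (≡-sym u≡su)
  Adjacent-irrefl u (inj₂ u≡su) = s-moves u (≡-sym u≡su)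

  graph : Graph
  graph = record
    { n      = n
    ; adj    = λ u v → does (adjacent? u v)
    ; sym    = λ u v → does-⇔ (mk⇔ Adjacent-sym Adjacent-sym) (adjacent? u v) (adjacent? v u)
    ; irrefl = λ u → dec-false (adjacent? u u) (Adjacent-irrefl u)
    }

  adjacent : ∀ {u v} → adj graph u v ≡ true → Adjacent u v
  adjacent {u} {v} = does⇒ (adjacent? u v)

  orbit-distinct : ∀ x {t t′} → t < t′ → t′ ≤ k → fold x s t ≢ fold x s t′
  orbit-distinct x {t} {t′} t<t′ t′≤k same = aperiodic (t′ ∸ t) (fold x s t) (m<n⇒0<n∸m t<t′) gap≤k returns
    where
    gap≤k : t′ ∸ t < suc k
    gap≤k = s≤s (≤-trans (m∸n≤m t′ t) t′≤k)
    returns : fold (fold x s t) s (t′ ∸ t) ≡ fold x s t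
    returns = trans (≡-sym (fold-+ s x (t′ ∸ t) t)) (trans (cong (fold x s) (m∸n+n≡m (<⇒≤ t<t′))) (≡-sym same))

  orbit-injective : ∀ x {t t′} → t ≤ k → t′ ≤ k → fold x s t ≡ fold x s t′ → t ≡ t′
  orbit-injective x {t} {t′} t≤k t′≤k same with <-cmp t t′
  ... | tri< t<t′ _ _ = contradiction same (orbit-distinct x t<t′ t′≤k)
  ... | tri≈ _ t≡t′ _ = t≡t′
  ... | tri> _ _ t′<t = contradiction (≡-sym same) (orbit-distinct x t′<t t≤k)

  orbit-cycle : ∀ x → fold x s (suc k) ≡ x → Cycle graph k
  orbit-cycle x period = record
    { c     = λ t → fold x s (toℕ t)
    ; inj   = λ same → toℕ-injective (orbit-injective x (s≤s⁻¹ (toℕ<n _)) (s≤s⁻¹ (toℕ<n _)) same)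
    ; step  = λ j → dec-true (adjacent? _ _) (inj₁ (cong (λ t → s (fold x s t)) (≡-sym (toℕ-inject₁ j))))
    ; close = dec-true (adjacent? _ _) (inj₁ (trans (≡-sym period) (cong (λ t → s (fold x s t)) (≡-sym (toℕ-fromℕ k)))))
    }

  -- A cycle of length ℓ + 1 ≥ 3 contains the s-orbit of each of its vertices,
  -- hence at least k + 1 vertices.
  module _ {ℓ} (C : Cycle graph ℓ) (2≤ℓ : 2 ≤ ℓ) where
    open Cycle C

    prev : Fin (suc ℓ) → Fin (suc ℓ)
    prev i = fold i rot ℓ

    prev≢next : ∀ i → prev i ≢ rot i
    prev≢next i same = rot-aperiodic 2 i (s≤s z≤n) (s≤s 2≤ℓ) (trans (cong rot (≡-sym same)) (rot-period i))

    -- Of the two cycle neighbours c (prev i) and c (rot i) of c i, one is s (c i).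
    succ-on-cycle : ∀ i → ∃ λ j → c j ≡ s (c i)
    succ-on-cycle i with adjacent (cycle-step C i)
                       | adjacent (subst (λ j → adj graph (c (prev i)) (c j) ≡ true) (rot-period i) (cycle-step C (prev i)))
    ... | inj₁ next≡si | _            = rot i , next≡si
    ... | inj₂ _       | inj₂ prev≡si = prev i , prev≡si
    ... | inj₂ i≡snext | inj₁ i≡sprev = contradiction (inj (s-injective (trans (≡-sym i≡sprev) i≡snext))) (prev≢next i)

    orbit-on-cycle : ∀ t → ∃ λ j → c j ≡ fold (c fzero) s t
    orbit-on-cycle zero    = fzero , refl
    orbit-on-cycle (suc t) with orbit-on-cycle t
    ... | j , cj≡ with succ-on-cycle j
    ... | j′ , cj′≡ = j′ , trans cj′≡ (cong s cj≡)

    long : suc k ≤ suc ℓ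
    long = injective⇒≤ {f = position} position-injective
      where
      position : Fin (suc k) → Fin (suc ℓ)
      position t = proj₁ (orbit-on-cycle (toℕ t))
      position-injective : Injective _≡_ _≡_ position
      position-injective {t} {t′} same = toℕ-injective (orbit-injective (c fzero) (s≤s⁻¹ (toℕ<n t)) (s≤s⁻¹ (toℕ<n t′))
        (trans (≡-sym (proj₂ (orbit-on-cycle (toℕ t)))) (trans (cong c same) (proj₂ (orbit-on-cycle (toℕ t′))))))

  girth : ∀ x → fold x s (suc k) ≡ x → HasGirth graph (suc k)
  girth x period = (s≤s 2≤k , orbit-cycle x period) , no-shorter
    where
    no-shorter : ∀ ℓ → ℓ < suc k → ¬ HasCycleOfLength graph ℓ
    no-shorter (suc ℓ) ℓ<g (3≤ℓ , C) = <⇒≱ ℓ<g (long C (s≤s⁻¹ 3≤ℓ))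

  Proper⇔Twisted : ∀ {m} (τ : Fin n → Fin m → Fin m) → (∀ u x → τ u x ≡ x) → ∀ c → Proper graph m c ⇔ Twisted s τ c
  Proper⇔Twisted τ τ≗id c = mk⇔
    (λ proper u → ≢-cong refl (≡-sym (τ≗id u _)) (≢-sym (proper u (s u) (dec-true (adjacent? u (s u)) (inj₁ refl)))))
    (λ twisted u v uv → along (adjacent uv) twisted)
    where
    along : ∀ {u v} → Adjacent u v → Twisted s τ c → lookup c u ≢ lookup c v
    along {u} (inj₁ refl) twisted = ≢-sym (≢-cong refl (τ≗id u _) (twisted u))
    along {v = v} (inj₂ refl) twisted = ≢-cong refl (τ≗id v _) (twisted v)

  chromPoly≡#Twisted : ∀ {m} (τ : Fin n → Fin m → Fin m) → (∀ u x → τ u x ≡ x) → chromPoly graph m ≡ #Twisted m s τ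
  chromPoly≡#Twisted {m} τ τ≗id = trans (countL≡∑𝟙 (proper? graph m) (allVecs n (allFin m)))
    (∑V-cong (allFin m) n (λ c → 𝟙-⇔ (proper? graph m c) (twisted? s τ c) (Proper⇔Twisted τ τ≗id c)))

  -- The cover of the successor graph twisted by τ: the matching between L(u)
  -- and L(s u) joins (u , i) to (s u , τ u i).
  module _ {m : ℕ} (τ : Fin n → Fin m → Fin m) (τ-injective : ∀ u → Injective _≡_ _≡_ (τ u)) where

    Linked : Fin n → Fin m → Fin n → Fin m → Set
    Linked u i v j = (u ≡ v × i ≢ j) ⊎ (v ≡ s u × j ≡ τ u i) ⊎ (u ≡ s v × i ≡ τ v j)

    linked? : ∀ u i v j → Dec (Linked u i v j)
    linked? u i v j = ((u ≟ v) ×-dec ¬? (i ≟ j)) ⊎-dec (((v ≟ s u) ×-dec (j ≟ τ u i)) ⊎-dec ((u ≟ s v) ×-dec (i ≟ τ v j)))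

    Linked-sym : ∀ {u i v j} → Linked u i v j → Linked v j u i
    Linked-sym (inj₁ (u≡v , i≢j)) = inj₁ (≡-sym u≡v , ≢-sym i≢j)
    Linked-sym (inj₂ (inj₁ down)) = inj₂ (inj₂ down)
    Linked-sym (inj₂ (inj₂ up))   = inj₂ (inj₁ up)

    Linked-irrefl : ∀ u i → ¬ Linked u i u i
    Linked-irrefl u i (inj₁ (_ , i≢i))      = i≢i refl
    Linked-irrefl u i (inj₂ (inj₁ (u≡su , _))) = s-moves u (≡-sym u≡su)
    Linked-irrefl u i (inj₂ (inj₂ (u≡su , _))) = s-moves u (≡-sym u≡su)

    Linked⇒edge : ∀ {u i v j} → Linked u i v j → u ≡ v ⊎ adj graph u v ≡ true
    Linked⇒edge (inj₁ (u≡v , _))      = inj₁ u≡v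
    Linked⇒edge {u} {v = v} (inj₂ (inj₁ (v≡su , _))) = inj₂ (dec-true (adjacent? u v) (inj₁ v≡su))
    Linked⇒edge {u} {v = v} (inj₂ (inj₂ (u≡sv , _))) = inj₂ (dec-true (adjacent? u v) (inj₂ u≡sv))

    unique-partner : ∀ {u v} → Adjacent u v → ∀ {i j j′} → Linked u i v j → Linked u i v j′ → j ≡ j′
    unique-partner uv (inj₁ (refl , _)) _ = contradiction uv (Adjacent-irrefl _)
    unique-partner uv _ (inj₁ (refl , _)) = contradiction uv (Adjacent-irrefl _)
    unique-partner uv (inj₂ (inj₁ (_ , j≡))) (inj₂ (inj₁ (_ , j′≡))) = trans j≡ (≡-sym j′≡)
    unique-partner uv (inj₂ (inj₂ (_ , i≡))) (inj₂ (inj₂ (_ , i≡′))) = τ-injective _ (trans (≡-sym i≡) i≡′)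
    unique-partner uv (inj₂ (inj₁ (refl , _))) (inj₂ (inj₂ (u≡ssu , _))) = contradiction (≡-sym u≡ssu) (s²-moves _)
    unique-partner uv (inj₂ (inj₂ (u≡sv , _))) (inj₂ (inj₁ (refl , _))) = contradiction (≡-sym u≡sv) (s²-moves _)

    cover : Cover graph m
    cover = record
      { hadj     = λ u i v j → does (linked? u i v j)
      ; hsym     = λ u i v j → does-⇔ (mk⇔ Linked-sym Linked-sym) (linked? u i v j) (linked? v j u i)
      ; hirrefl  = λ u i → dec-false (linked? u i u i) (Linked-irrefl u i)
      ; clique   = λ u i j i≢j → dec-true (linked? u i u j) (inj₁ (refl , i≢j))
      ; edgeOnly = λ u i v j l → Linked⇒edge (does⇒ (linked? u i v j) l)
      ; matching = λ u v uv →
          (λ i j j′ l l′ → unique-partner (adjacent uv) (does⇒ (linked? u i v j) l) (does⇒ (linked? u i v j′) l′))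
        , (λ i i′ j l l′ → unique-partner (Adjacent-sym (adjacent uv))
                             (Linked-sym (does⇒ (linked? u i v j) l)) (Linked-sym (does⇒ (linked? u i′ v j) l′)))
      }

    Independent⇔Twisted : ∀ c → Independent-colouring cover c ⇔ Twisted s τ c
    Independent⇔Twisted c = mk⇔
      (λ independent u clash → contradiction (trans (≡-sym (independent u (s u)))
                                 (dec-true (linked? u _ (s u) _) (inj₂ (inj₁ (refl , clash))))) λ ())
      (λ twisted u v → dec-false (linked? u _ v _) (unlinked twisted))
      where
      unlinked : Twisted s τ c → ∀ {u v} → ¬ Linked u (lookup c u) v (lookup c v)
      unlinked twisted (inj₁ (refl , differ))       = differ refl
      unlinked twisted {u} (inj₂ (inj₁ (refl , clash))) = twisted u clash
      unlinked twisted {v = v} (inj₂ (inj₂ (refl , clash))) = twisted v clash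

    dpCount≡#Twisted : dpCount cover ≡ #Twisted m s τ
    dpCount≡#Twisted = trans (dpCount≡#independent cover)
      (∑V-cong (allFin m) n (λ c → 𝟙-⇔ (independent-colouring? cover c) (twisted? s τ c) (Independent⇔Twisted c)))

  dp-below-chromatic : ∀ {m} (τ : Fin n → Fin m → Fin m) (τ-injective : ∀ u → Injective _≡_ _≡_ (τ u)) →
    #Twisted m s τ < chromPoly graph m → Σ ℕ λ v → IsDPChromaticValue graph m v × v < chromPoly graph m
  dp-below-chromatic {m} τ τ-injective fewer with CoverSearch.dpChromatic graph m (cover τ τ-injective)
  ... | v , is-value , v≤ = v , is-value , ≤-<-trans v≤ (subst (_< chromPoly graph m) (≡-sym (dpCount≡#Twisted τ τ-injective)) fewer)

-- The example: G is the disjoint union of a cycle of length g = k + 1 and an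
-- even cycle of length 2g, realised as the successor graph of two rotations
-- side by side.
module CycleUnion (k : ℕ) (2≤k : 2 ≤ k) where

  -- The second cycle has k′ + 1 = 2 (k + 1) vertices.
  k′ : ℕ
  k′ = suc (k * 2)

  s : Fin (suc k + suc k′) → Fin (suc k + suc k′)
  s = rot {k} ⊕ rot {k′}

  s-aperiodic : Aperiodic s (suc k)
  s-aperiodic = ⊕-aperiodic rot rot rot-aperiodic (λ d x 0<d d<g → rot-aperiodic d x 0<d (≤-trans d<g (s≤s k≤k′)))
    where
    k≤k′ : k ≤ k′
    k≤k′ = ≤-trans (m≤m*n k 2) (n≤1+n (k * 2))

  open SuccessorGraph s (⊕-injective rot rot rot-injective rot-injective) k 2≤k s-aperiodic public

  G-girth : HasGirth graph (suc k)
  G-girth = girth (fzero ↑ˡ suc k′) (trans (fold-⊕-↑ˡ rot rot fzero (suc k)) (cong (_↑ˡ suc k′) (rot-period fzero)))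

  -- With m = m″ + 3 colours, compare the untwisted colourings (the proper
  -- ones) with those twisted by a rotation of the colours on the closing
  -- edge of the even cycle.
  module _ (m″ : ℕ) where
    open CycleColourings (suc m″)

    untwisted twisted : Fin (suc k + suc k′) → Colour → Colour
    untwisted = atLast (λ x → x) ⊞ atLast (λ x → x)
    twisted   = atLast (λ x → x) ⊞ atLast rot

    twisted-injective : ∀ u → Injective _≡_ _≡_ (twisted u)
    twisted-injective = ⊞-elim (atLast (λ x → x)) (atLast rot) (λ t → Injective _≡_ _≡_ t)
                          (atLast-injective (λ x → x) (λ same → same)) (atLast-injective rot rot-injective)

    -- m P k · m Q k′ < m P k · m P k′, because Q k′ < P k′ (k′ is odd) and the
    -- first cycle has some proper colouring.
    fewer-DP-colourings : #Twisted m s twisted < chromPoly graph m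
    fewer-DP-colourings = begin-strict
      #Twisted m s twisted
        ≡⟨ #Twisted-⊕ (rot {k}) (rot {k′}) (atLast (λ x → x)) (atLast rot) ⟩
      #Twisted m rot (atLast {k} (λ x → x)) * #Twisted m rot (atLast {k′} rot)
        ≡⟨ cong₂ _*_ (#Twisted-untwisted k) (#Twisted-deranged k′ rot rot-moves) ⟩
      (m * P k) * (m * Q k′)
        <⟨ *-monoʳ-< (m * P k) {{>-nonZero short-cycle-colourable}} (*-monoʳ-< m (Q<P-odd k)) ⟩
      (m * P k) * (m * P k′)
        ≡⟨ ≡-sym (cong₂ _*_ (#Twisted-untwisted k) (#Twisted-untwisted k′)) ⟩
      #Twisted m rot (atLast {k} (λ x → x)) * #Twisted m rot (atLast {k′} (λ x → x))
        ≡⟨ ≡-sym (#Twisted-⊕ (rot {k}) (rot {k′}) (atLast (λ x → x)) (atLast (λ x → x))) ⟩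
      #Twisted m s untwisted
        ≡⟨ ≡-sym (chromPoly≡#Twisted untwisted untwisted≗id) ⟩
      chromPoly graph m ∎
      where
      open ≤-Reasoning
      rot-moves : ∀ x → rot x ≢ x
      rot-moves x = rot-aperiodic 1 x (s≤s z≤n) (s≤s (s≤s z≤n))
      short-cycle-colourable : 0 < m * P k
      short-cycle-colourable = *-mono-≤ {1} {m} (s≤s z≤n) (P-positive (s≤s z≤n) k (≤-trans (s≤s z≤n) 2≤k))
      untwisted≗id : ∀ u x → untwisted u x ≡ x
      untwisted≗id = ⊞-elim (atLast (λ x → x)) (atLast (λ x → x)) (λ t → ∀ x → t x ≡ x) atLast-id atLast-id

    dp-below : Σ ℕ λ v → IsDPChromaticValue graph m v × v < chromPoly graph m
    dp-below = dp-below-chromatic twisted twisted-injective fewer-DP-colourings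

corollary1p5 : ∀ (g : ℕ) → 3 ≤ g →
    Σ Graph (λ G → HasGirth G g × Σ ℕ (λ N → ∀ (m : ℕ) → N ≤ m →
      Σ ℕ (λ k → IsDPChromaticValue G m k × k < chromPoly G m)))
corollary1p5 (suc k) 3≤g = graph , G-girth , 3 , enough-colours
  where
  open CycleUnion k (s≤s⁻¹ 3≤g)
  enough-colours : ∀ m → 3 ≤ m → Σ ℕ (λ v → IsDPChromaticValue graph m v × v < chromPoly graph m)
  enough-colours (suc (suc (suc m″))) _ = dp-below m″
  enough-colours (suc zero)       (s≤s ())
  enough-colours (suc (suc zero)) (s≤s (s≤s ()))
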